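{- Let $n\ge 0$ and $\sigma\in S_{n+1}(T_1)\cup S_{n+1}(T_2)$. Then $\Phi(\sigma)$ is a Dyck path if and only if $\sigma(n+1)=n+1$.
   Context: A permutation $\sigma$ avoids $\tau$ if no subsequence of $\sigma$ has the same relative order as $\tau$. Let $T_1=\{3214,3241,4213,4231\}$ and $T_2=\{3124,3142,4123,4132\}$; $Av(T)$ is the set of permutations avoiding all patterns of $T$, and $S_n(T)=Av(T)\cap S_n$. A Dyck prefix is a lattice path starting at the origin with steps $U=(1,1)$ and $D=(1,-1)$ that never goes below the $x$-axis (equivalently a word in $U,D$ each of whose initial subwords has at least as many $U$'s as $D$'s); a Dyck path is a Dyck prefix ending on the $x$-axis. The map $\Phi$ from $Av(T_1)\cup Av(T_2)$ to Dyck prefixes is defined as follows. The permutation $1$ is mapped to the empty path. For $n\ge1$ and $\sigma\in S_{n+1}(T_1)\cup S_{n+1}(T_2)$, write $\sigma=M_1w_1M_2w_2\cdots M_kw_k$, where $M_1<\cdots<M_k=n+1$ are the left-to-right maxima of $\sigma$ (entries larger than all preceding entries) and $w_i$ is a possibly empty word of length $l_i$; set $M_0=0$. If $w_k$ is empty, $\Phi(\sigma)=U^{M_1-M_0}D^{l_1+1}U^{M_2-M_1}D^{l_2+1}\cdots U^{M_{k-1}-M_{k-2}}D^{l_{k-1}+1}$. If $w_k=x_1\cdots x_{l_k}$ is nonempty, $\Phi(\sigma)=U^{M_1-M_0}D^{l_1+1}\cdots U^{M_{k-1}-M_{k-2}}D^{l_{k-1}+1}U^{M_k-M_{k-1}}Q_1\cdots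 Q_{l_k-1}$, where $Q_j=U$ if $x_j=\max\{x_j,x_{j+1},\dots,x_{l_k}\}$ and $Q_j=D$ otherwise. ($\Phi(\sigma)$ is a Dyck prefix of length $2n$.) -}

module Defs where

open import Data.Nat using (ℕ; zero; suc; _<_; _∸_; _⊔_; _<?_; _≟_)
open import Data.List using (List; []; _∷_; _++_; replicate; length; foldr; map; upTo)
open import Data.List.Relation.Binary.Sublist.Propositional using (_⊆_)
open import Data.List.Relation.Binary.Pointwise using (Pointwise)
open import Data.List.Relation.Unary.All using (All)
open import Data.Product using (_×_; _,_; ∃)
open import Data.Unit using (⊤)
open import Data.Empty using (⊥)
open import Relation.Nullary using (¬_; yes; no)
open import Relation.Binary.PropositionalEquality using (_≡_)

-- Permutations of [n] = {1,…,n} are represented in one-line notation as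
-- lists of naturals; σ ∈ S_n iff σ is a rearrangement of [1,…,n].
IsPerm : ℕ → List ℕ → Set
IsPerm n σ = σ ↭ map suc (upTo n)
  where open import Data.List.Relation.Binary.Permutation.Propositional using (_↭_)

OrderIso : List ℕ → List ℕ → Set
OrderIso [] [] = ⊤
OrderIso [] (_ ∷ _) = ⊥
OrderIso (_ ∷ _) [] = ⊥
OrderIso (x ∷ xs) (y ∷ ys) =
  Pointwise (λ a b → (x < a → y < b) × (y < b → x < a)) xs ys
  × Pointwise (λ a b → (a < x → b < y) × (b < y → a < x)) xs ys
  × OrderIso xs ys

Contains : List ℕ → List ℕ → Set
Contains σ τ = ∃ λ s → (s ⊆ σ) × OrderIso s τ

Avoids : List ℕ → List ℕ → Set
Avoids σ τ = ¬ Contains σ τ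

AvoidsAll : List (List ℕ) → List ℕ → Set
AvoidsAll T σ = All (Avoids σ) T

T₁ : List (List ℕ)
T₁ = (3 ∷ 2 ∷ 1 ∷ 4 ∷ []) ∷ (3 ∷ 2 ∷ 4 ∷ 1 ∷ []) ∷ (4 ∷ 2 ∷ 1 ∷ 3 ∷ []) ∷ (4 ∷ 2 ∷ 3 ∷ 1 ∷ []) ∷ []

T₂ : List (List ℕ)
T₂ = (3 ∷ 1 ∷ 2 ∷ 4 ∷ []) ∷ (3 ∷ 1 ∷ 4 ∷ 2 ∷ []) ∷ (4 ∷ 1 ∷ 2 ∷ 3 ∷ []) ∷ (4 ∷ 1 ∷ 3 ∷ 2 ∷ []) ∷ []

data Step : Set where
  U D : Step

-- Decomposition σ = M₁ w₁ M₂ w₂ ⋯ M_k w_k by left-to-right maxima.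
-- blocksFrom m xs: given current maximum m, returns the rest of the current
-- block's word and the subsequent blocks.
blocksFrom : ℕ → List ℕ → List ℕ × List (ℕ × List ℕ)
blocksFrom m [] = [] , []
blocksFrom m (x ∷ xs) with m <? x
... | yes _ with blocksFrom x xs
...   | w , bs = [] , ((x , w) ∷ bs)
blocksFrom m (x ∷ xs) | no _ with blocksFrom m xs
...   | w , bs = (x ∷ w) , bs

blocks : List ℕ → List (ℕ × List ℕ)
blocks [] = []
blocks (x ∷ xs) with blocksFrom x xs
... | w , bs = (x , w) ∷ bs

maxList : List ℕ → ℕ
maxList = foldr _⊔_ 0

-- Q₁ ⋯ Q_{l-1} for the last word x₁ ⋯ x_l
qStep : ℕ → List ℕ → Step
qStep x rest with x ⊔ maxList rest ≟ x
... | yes _ = U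
... | no _ = D

Qs : List ℕ → List Step
Qs [] = []
Qs (x ∷ []) = []
Qs (x ∷ y ∷ ys) = qStep x (y ∷ ys) ∷ Qs (y ∷ ys)

-- phiBlocks prev bs, where prev = M_{i-1}
phiBlocks : ℕ → List (ℕ × List ℕ) → List Step
phiBlocks prev [] = []
phiBlocks prev ((M , []) ∷ []) = []
phiBlocks prev ((M , (x ∷ w)) ∷ []) = replicate (M ∸ prev) U ++ Qs (x ∷ w)
phiBlocks prev ((M , w) ∷ (b ∷ bs)) =
  replicate (M ∸ prev) U ++ replicate (suc (length w)) D ++ phiBlocks M (b ∷ bs)

Φ : List ℕ → List Step
Φ σ = phiBlocks 0 (blocks σ)

DyckPrefixFrom : ℕ → List Step → Set
DyckPrefixFrom h [] = ⊤
DyckPrefixFrom h (U ∷ p) = DyckPrefixFrom (suc h) p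
DyckPrefixFrom zero (D ∷ p) = ⊥
DyckPrefixFrom (suc h) (D ∷ p) = DyckPrefixFrom h p

DyckPathFrom : ℕ → List Step → Set
DyckPathFrom h [] = h ≡ 0
DyckPathFrom h (U ∷ p) = DyckPathFrom (suc h) p
DyckPathFrom zero (D ∷ p) = ⊥
DyckPathFrom (suc h) (D ∷ p) = DyckPathFrom h p

IsDyckPrefix : List Step → Set
IsDyckPrefix = DyckPrefixFrom 0

IsDyckPath : List Step → Set
IsDyckPath = DyckPathFrom 0

module Submission where

-- Write σ = M₁w₁ ⋯ M_k w_k by left-to-right
-- maxima and let cᵢ = |M₁w₁ ⋯ Mᵢwᵢ|.  After the i-th "U^{Mᵢ-Mᵢ₋₁} D^{lᵢ+1}"
-- group (i < k) the path is at height Mᵢ - cᵢ, which is ≥ 0 because the first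
-- cᵢ entries of σ are distinct numbers ≤ Mᵢ; heights inside a group never drop
-- below its end point.  Hence the path is a Dyck prefix up to block k, and the
-- question is decided by the last block, where M_k = N:
--   * w_k empty: σ ends with N, and the path stops at height M_{k-1} - c_{k-1}
--     = 0, because the first c_{k-1} entries are exactly {1..M_{k-1}};
--   * w_k nonempty: σ does not end with N (N occurs once), and the remaining
--     |w_k| - 1 steps start at height N - c_{k-1} = |w_k| + 1, too high to return.

open import Defs
open import Data.Nat using (ℕ; zero; suc; _+_; _∸_; _≤_; _<_; _≤?_; _<?_; z≤n; s≤s)
open import Data.Nat.Properties
open import Data.List using (List; []; _∷_; _++_; _∷ʳ_; length; filter; map; upTo; replicate; last)
open import Data.List.Properties
  using (length-++; filter-++; filter-all; filter-none; filter-reject; length-filter; ++-assoc; ++-identityʳ; map-++; upTo-∷ʳ; length-map; length-applyUpTo)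
open import Data.List.Relation.Unary.All as All using (All; []; _∷_)
open import Data.List.Relation.Unary.All.Properties using (++⁺; ++⁻ʳ)
open import Data.List.Relation.Binary.Permutation.Propositional using (↭-sym)
open import Data.List.Relation.Binary.Permutation.Propositional.Properties using (All-resp-↭; filter-↭; ↭-length)
open import Data.Maybe using (just)
open import Data.Sum using (_⊎_; inj₁; inj₂)
open import Data.Product using (Σ; _×_; _,_; proj₂)
open import Data.Unit using (⊤; tt)
open import Data.Empty using (⊥; ⊥-elim)
open import Level using (0ℓ)
open import Relation.Nullary using (¬_; yes; no; contradiction)
open import Function.Base using (_∘′_)
open import Function.Bundles using (_⇔_; mk⇔; Equivalence)
open import Function.Construct.Identity using (⇔-id)
open import Function.Properties.Equivalence using (⇔-setoid)
open import Relation.Binary.PropositionalEquality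
import Relation.Binary.Reasoning.Setoid as SetoidReasoning

module ⇔-Reasoning = SetoidReasoning (⇔-setoid 0ℓ)

up-⇔ : ∀ h a p → DyckPathFrom h (replicate a U ++ p) ⇔ DyckPathFrom (h + a) p
up-⇔ h zero p rewrite +-identityʳ h = ⇔-id _
up-⇔ h (suc a) p rewrite +-suc h a = up-⇔ (suc h) a p

down-⇔ : ∀ b h p → DyckPathFrom (b + h) (replicate b D ++ p) ⇔ DyckPathFrom h p
down-⇔ zero h p = ⇔-id _
down-⇔ (suc b) h p = down-⇔ b h p

dyckPath-length : ∀ h p → DyckPathFrom h p → h ≤ length p
dyckPath-length h [] refl = z≤n
dyckPath-length h (U ∷ p) d = ≤-trans (n≤1+n h) (m≤n⇒m≤1+n (dyckPath-length (suc h) p d))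
dyckPath-length zero (D ∷ p) d = z≤n
dyckPath-length (suc h) (D ∷ p) d = s≤s (dyckPath-length h p d)

length-Qs : ∀ x w → length (Qs (x ∷ w)) ≡ length w
length-Qs x [] = refl
length-Qs x (y ∷ w) = cong suc (length-Qs y w)

#≤ : ℕ → List ℕ → ℕ
#≤ M xs = length (filter (_≤? M) xs)

#≤-++ : ∀ M xs ys → #≤ M (xs ++ ys) ≡ #≤ M xs + #≤ M ys
#≤-++ M xs ys = trans (cong length (filter-++ (_≤? M) xs ys)) (length-++ (filter (_≤? M) xs))

#≤-all : ∀ {M xs} → All (_≤ M) xs → #≤ M xs ≡ length xs
#≤-all {M} xs≤M = cong length (filter-all (_≤? M) xs≤M)

#≤-none : ∀ {M xs} → All (λ x → ¬ x ≤ M) xs → #≤ M xs ≡ 0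
#≤-none {M} xs≰M = cong length (filter-none (_≤? M) xs≰M)

#≤-skip : ∀ {M x} xs → ¬ x ≤ M → #≤ M (x ∷ xs) ≡ #≤ M xs
#≤-skip {M} xs x≰M = cong length (filter-reject (_≤? M) x≰M)

range : ℕ → List ℕ
range N = map suc (upTo N)

range-suc : ∀ N → range (suc N) ≡ range N ++ suc N ∷ []
range-suc N = trans (cong (map suc) (sym (upTo-∷ʳ N))) (map-++ suc (upTo N) (N ∷ []))

length-range : ∀ N → length (range N) ≡ N
length-range N = trans (length-map suc (upTo N)) (length-applyUpTo (λ x → x) N)

range-bounded : ∀ N → All (λ x → 1 ≤ x × x ≤ N) (range N)
range-bounded zero = []
range-bounded (suc N) rewrite range-suc N =
  ++⁺ (All.map (λ (1≤x , x≤N) → 1≤x , m≤n⇒m≤1+n x≤N) (range-bounded N)) ((s≤s z≤n , ≤-refl) ∷ [])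

#≤-range : ∀ M N → M ≤ N → #≤ M (range N) ≡ M
#≤-range M zero z≤n = refl
#≤-range M (suc N) M≤1+N with m≤n⇒m<n∨m≡n M≤1+N
... | inj₂ refl = trans (#≤-all (All.map proj₂ (range-bounded (suc N)))) (length-range (suc N))
... | inj₁ M<1+N = begin
  #≤ M (range (suc N))                 ≡⟨ cong (#≤ M) (range-suc N) ⟩
  #≤ M (range N ++ suc N ∷ [])         ≡⟨ #≤-++ M (range N) (suc N ∷ []) ⟩
  #≤ M (range N) + #≤ M (suc N ∷ [])   ≡⟨ cong₂ _+_ (#≤-range M N (≤-pred M<1+N)) (#≤-none (<⇒≱ M<1+N ∷ [])) ⟩
  M + 0                                ≡⟨ +-identityʳ M ⟩
  M                                    ∎
  where open ≡-Reasoning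

last-++ : ∀ {A : Set} (xs : List A) y ys → last (xs ++ y ∷ ys) ≡ last (y ∷ ys)
last-++ [] y ys = refl
last-++ (x ∷ []) y ys = refl
last-++ (x ∷ x′ ∷ xs) y ys = last-++ (x′ ∷ xs) y ys

last-split : ∀ {A : Set} (xs : List A) y → last xs ≡ just y → Σ (List A) λ ys → xs ≡ ys ∷ʳ y
last-split (x ∷ []) y refl = [] , refl
last-split (x ∷ x′ ∷ xs) y eq with last-split (x′ ∷ xs) y eq
... | ys , xs≡ = x ∷ ys , cong (x ∷_) xs≡

flatten : List (ℕ × List ℕ) → List ℕ
flatten [] = []
flatten ((M , w) ∷ bs) = M ∷ w ++ flatten bs

GoodFrom : ℕ → List (ℕ × List ℕ) → Set
GoodFrom prev [] = ⊤
GoodFrom prev ((M , w) ∷ bs) = prev < M × All (_≤ M) w × GoodFrom M bs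

Decomposes : ℕ → List ℕ → List ℕ × List (ℕ × List ℕ) → Set
Decomposes m xs (w , bs) = (xs ≡ w ++ flatten bs) × All (_≤ m) w × GoodFrom m bs

blocksFrom-decomposes : ∀ m xs → Decomposes m xs (blocksFrom m xs)
blocksFrom-decomposes m [] = refl , [] , tt
blocksFrom-decomposes m (x ∷ xs) with m <? x
... | yes m<x with blocksFrom-decomposes x xs
...   | xs≡ , w≤x , good = cong (x ∷_) xs≡ , [] , m<x , w≤x , good
blocksFrom-decomposes m (x ∷ xs) | no m≮x with blocksFrom-decomposes m xs
...   | xs≡ , w≤m , good = cong (x ∷_) xs≡ , ≮⇒≥ m≮x ∷ w≤m , good

phiBlocks-step : ∀ prev M w b bs → phiBlocks prev ((M , w) ∷ b ∷ bs) ≡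
  replicate (M ∸ prev) U ++ replicate (suc (length w)) D ++ phiBlocks M (b ∷ bs)
phiBlocks-step prev M [] b bs = refl
phiBlocks-step prev M (x ∷ w) b bs = refl

block-bounded : ∀ {prev M pre w} → All (_≤ prev) pre → prev < M → All (_≤ M) w →
  All (_≤ M) (pre ++ M ∷ w)
block-bounded pre≤prev prev<M w≤M =
  ++⁺ (All.map (λ x≤prev → ≤-trans x≤prev (<⇒≤ prev<M)) pre≤prev) (≤-refl ∷ w≤M)

-- Height bookkeeping: climbing from prev - c to the new maximum M reaches M - c …
climb : ∀ {c prev M} → c ≤ prev → prev ≤ M → (prev ∸ c) + (M ∸ prev) ≡ M ∸ c
climb {c} {prev} {M} c≤prev prev≤M = begin
  (prev ∸ c) + (M ∸ prev)   ≡⟨ +-comm (prev ∸ c) (M ∸ prev) ⟩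
  (M ∸ prev) + (prev ∸ c)   ≡⟨ sym (+-∸-assoc (M ∸ prev) c≤prev) ⟩
  (M ∸ prev + prev) ∸ c     ≡⟨ cong (_∸ c) (m∸n+n≡m prev≤M) ⟩
  M ∸ c                     ∎
  where open ≡-Reasoning

-- … and descending s further steps leaves the path at M - (c + s).
block-height : ∀ {c prev M} s → c ≤ prev → prev ≤ M → c + s ≤ M →
  (prev ∸ c) + (M ∸ prev) ≡ s + (M ∸ (c + s))
block-height {c} {prev} {M} s c≤prev prev≤M c+s≤M = begin
  (prev ∸ c) + (M ∸ prev)   ≡⟨ climb c≤prev prev≤M ⟩
  M ∸ c                     ≡⟨ sym (m+[n∸m]≡n s≤M∸c) ⟩
  s + (M ∸ c ∸ s)           ≡⟨ cong (s +_) (∸-+-assoc M c s) ⟩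
  s + (M ∸ (c + s))         ∎
  where
    open ≡-Reasoning
    s≤M∸c : s ≤ M ∸ c
    s≤M∸c = m+n≤o⇒m≤o∸n s (subst (_≤ M) (+-comm c s) c+s≤M)

module Permutation (n : ℕ) {σ : List ℕ} (perm : IsPerm (suc n) σ) where

  N : ℕ
  N = suc n

  length-σ : length σ ≡ N
  length-σ = trans (↭-length perm) (length-range N)

  σ-bounded : All (λ x → 1 ≤ x × x ≤ N) σ
  σ-bounded = All-resp-↭ (↭-sym perm) (range-bounded N)

  #≤-σ : ∀ {M} → M ≤ N → #≤ M σ ≡ M
  #≤-σ {M} M≤N = trans (↭-length (filter-↭ (_≤? M) perm)) (#≤-range M N M≤N)

  entry-≤N : ∀ pre x post → σ ≡ pre ++ x ∷ post → x ≤ N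
  entry-≤N pre x post σ≡ with ++⁻ʳ pre (subst (All (_≤ N)) σ≡ (All.map proj₂ σ-bounded))
  ... | x≤N ∷ _ = x≤N

  prefix-count : ∀ {M} pre post → σ ≡ pre ++ post → All (_≤ M) pre → M ≤ N →
    length pre + #≤ M post ≡ M
  prefix-count {M} pre post σ≡ pre≤M M≤N = begin
    length pre + #≤ M post   ≡⟨ cong (_+ #≤ M post) (sym (#≤-all pre≤M)) ⟩
    #≤ M pre + #≤ M post     ≡⟨ sym (#≤-++ M pre post) ⟩
    #≤ M (pre ++ post)       ≡⟨ cong (#≤ M) (sym σ≡) ⟩
    #≤ M σ                   ≡⟨ #≤-σ M≤N ⟩
    M                        ∎
    where open ≡-Reasoning

  prefix-bound : ∀ {M} pre post → σ ≡ pre ++ post → All (_≤ M) pre → M ≤ N →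
    length pre ≤ M
  prefix-bound pre post σ≡ pre≤M M≤N =
    subst (length pre ≤_) (prefix-count pre post σ≡ pre≤M M≤N) (m≤m+n (length pre) _)

  prefix-exact : ∀ {M} pre post → σ ≡ pre ++ post → All (_≤ M) pre → All (M <_) post → M ≤ N →
    length pre ≡ M
  prefix-exact pre post σ≡ pre≤M M<post M≤N = begin
    length pre                 ≡⟨ sym (+-identityʳ (length pre)) ⟩
    length pre + 0             ≡⟨ cong (length pre +_) (sym (#≤-none (All.map <⇒≱ M<post))) ⟩
    length pre + #≤ _ post     ≡⟨ prefix-count pre post σ≡ pre≤M M≤N ⟩
    _                          ∎
    where open ≡-Reasoning

  max-is-N : ∀ {M} → All (_≤ M) σ → M ≤ N → M ≡ N
  max-is-N σ≤M M≤N = trans (sym (prefix-exact σ [] (sym (++-identityʳ σ)) σ≤M [] M≤N)) length-σ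

  N-once : ∀ pre mid post → σ ≡ pre ++ N ∷ mid ++ N ∷ post → ⊥
  N-once pre mid post σ≡ = <⇒≱ k<n n≤k
    where
      open ≡-Reasoning
      k : ℕ
      k = length pre + (length mid + length post)
      N≰n : ¬ N ≤ n
      N≰n = <⇒≱ ≤-refl
      count : #≤ n σ ≡ #≤ n pre + (#≤ n mid + #≤ n post)
      count = begin
        #≤ n σ                                           ≡⟨ cong (#≤ n) σ≡ ⟩
        #≤ n (pre ++ N ∷ mid ++ N ∷ post)                ≡⟨ #≤-++ n pre _ ⟩
        #≤ n pre + #≤ n (N ∷ mid ++ N ∷ post)            ≡⟨ cong (#≤ n pre +_) (#≤-skip (mid ++ N ∷ post) N≰n) ⟩
        #≤ n pre + #≤ n (mid ++ N ∷ post)                ≡⟨ cong (#≤ n pre +_) (#≤-++ n mid _) ⟩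
        #≤ n pre + (#≤ n mid + #≤ n (N ∷ post))          ≡⟨ cong (λ t → #≤ n pre + (#≤ n mid + t)) (#≤-skip post N≰n) ⟩
        #≤ n pre + (#≤ n mid + #≤ n post)                ∎
      n≤k : n ≤ k
      n≤k = subst (_≤ k) (trans (sym count) (#≤-σ (n≤1+n n)))
        (+-mono-≤ (length-filter (_≤? n) pre) (+-mono-≤ (length-filter (_≤? n) mid) (length-filter (_≤? n) post)))
      length-eq : N ≡ suc (suc k)
      length-eq = begin
        N                                                          ≡⟨ sym length-σ ⟩
        length σ                                                   ≡⟨ cong length σ≡ ⟩
        length (pre ++ N ∷ mid ++ N ∷ post)                        ≡⟨ length-++ pre ⟩
        length pre + suc (length (mid ++ N ∷ post))                ≡⟨ cong (λ t → length pre + suc t) (length-++ mid) ⟩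
        length pre + suc (length mid + suc (length post))          ≡⟨ cong (λ t → length pre + suc t) (+-suc (length mid) _) ⟩
        length pre + suc (suc (length mid + length post))          ≡⟨ +-suc (length pre) _ ⟩
        suc (length pre + suc (length mid + length post))          ≡⟨ cong suc (+-suc (length pre) _) ⟩
        suc (suc k)                                                ∎
      k<n : k < n
      k<n = subst (k <_) (suc-injective (sym length-eq)) ≤-refl

  final-empty : ∀ prev pre M → σ ≡ pre ++ M ∷ [] → All (_≤ prev) pre → prev < M →
    (prev ∸ length pre ≡ 0) ⇔ (last σ ≡ just N)
  final-empty prev pre M σ≡ pre≤prev prev<M = mk⇔ (λ _ → ends-N) (λ _ → at-axis)
    where
      M≡N : M ≡ N
      M≡N = max-is-N (subst (All (_≤ M)) (sym σ≡) (block-bounded pre≤prev prev<M []))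
                     (entry-≤N pre M [] σ≡)
      ends-N : last σ ≡ just N
      ends-N = trans (cong last σ≡) (trans (last-++ pre M []) (cong just M≡N))
      at-axis : prev ∸ length pre ≡ 0
      at-axis = trans (cong (prev ∸_) (prefix-exact pre (M ∷ []) σ≡ pre≤prev (prev<M ∷ [])
                        (≤-trans (<⇒≤ prev<M) (entry-≤N pre M [] σ≡))))
                      (n∸n≡0 prev)

  final-nonempty : ∀ prev pre M x w → σ ≡ pre ++ M ∷ x ∷ w → All (_≤ prev) pre → prev < M →
    All (_≤ M) (x ∷ w) →
    DyckPathFrom (prev ∸ length pre) (replicate (M ∸ prev) U ++ Qs (x ∷ w)) ⇔ (last σ ≡ just N)
  final-nonempty prev pre M x w σ≡ pre≤prev prev<M xw≤M = mk⇔ (⊥-elim ∘′ not-dyck) (⊥-elim ∘′ not-ending)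
    where
      c : ℕ
      c = length pre
      M≤N : M ≤ N
      M≤N = entry-≤N pre M (x ∷ w) σ≡
      M≡N : M ≡ N
      M≡N = max-is-N (subst (All (_≤ M)) (sym σ≡) (block-bounded pre≤prev prev<M xw≤M)) M≤N
      c≤prev : c ≤ prev
      c≤prev = prefix-bound pre _ σ≡ pre≤prev (≤-trans (<⇒≤ prev<M) M≤N)
      M≡c+2+w : M ≡ c + suc (suc (length w))
      M≡c+2+w = trans M≡N (trans (sym length-σ) (trans (cong length σ≡) (length-++ pre)))
      not-dyck : DyckPathFrom (prev ∸ c) (replicate (M ∸ prev) U ++ Qs (x ∷ w)) → ⊥
      not-dyck d = <⇒≱ (subst (length w <_) M∸c≡ (n≤1+n _)) M∸c≤w
        where
          M∸c≡ : suc (suc (length w)) ≡ M ∸ c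
          M∸c≡ = trans (sym (m+n∸m≡n c _)) (cong (_∸ c) (sym M≡c+2+w))
          M∸c≤w : M ∸ c ≤ length w
          M∸c≤w = subst₂ _≤_ (climb c≤prev (<⇒≤ prev<M)) (length-Qs x w)
                    (dyckPath-length _ (Qs (x ∷ w)) (Equivalence.to (up-⇔ (prev ∸ c) (M ∸ prev) (Qs (x ∷ w))) d))
      not-ending : last σ ≡ just N → ⊥
      not-ending ends-N with last-split (x ∷ w) N (trans (sym (trans (cong last σ≡) (last-++ pre M (x ∷ w)))) ends-N)
      ... | ys , xw≡ = N-once pre ys [] (trans σ≡ (cong₂ (λ m t → pre ++ m ∷ t) M≡N xw≡))

  blocks-Dyck : ∀ prev pre M w bs → σ ≡ pre ++ flatten ((M , w) ∷ bs) → All (_≤ prev) pre →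
    GoodFrom prev ((M , w) ∷ bs) →
    DyckPathFrom (prev ∸ length pre) (phiBlocks prev ((M , w) ∷ bs)) ⇔ (last σ ≡ just N)
  blocks-Dyck prev pre M [] [] σ≡ pre≤prev (prev<M , _) = final-empty prev pre M σ≡ pre≤prev prev<M
  blocks-Dyck prev pre M (x ∷ w) [] σ≡ pre≤prev (prev<M , xw≤M , _) =
    final-nonempty prev pre M x w (trans σ≡ (cong (λ t → pre ++ M ∷ x ∷ t) (++-identityʳ w)))
                   pre≤prev prev<M xw≤M
  blocks-Dyck prev pre M w ((M′ , w′) ∷ bs) σ≡ pre≤prev (prev<M , w≤M , good) = begin
    DyckPathFrom (prev ∸ c) (phiBlocks prev ((M , w) ∷ (M′ , w′) ∷ bs))
      ≡⟨ cong (DyckPathFrom (prev ∸ c)) (phiBlocks-step prev M w (M′ , w′) bs) ⟩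
    DyckPathFrom (prev ∸ c) (replicate (M ∸ prev) U ++ replicate s D ++ rest)
      ≈⟨ up-⇔ (prev ∸ c) (M ∸ prev) _ ⟩
    DyckPathFrom ((prev ∸ c) + (M ∸ prev)) (replicate s D ++ rest)
      ≡⟨ cong (λ h → DyckPathFrom h (replicate s D ++ rest)) height ⟩
    DyckPathFrom (s + (M ∸ length pre′)) (replicate s D ++ rest)
      ≈⟨ down-⇔ s (M ∸ length pre′) rest ⟩
    DyckPathFrom (M ∸ length pre′) rest
      ≈⟨ blocks-Dyck M pre′ M′ w′ bs σ≡′ (block-bounded pre≤prev prev<M w≤M) good ⟩
    (last σ ≡ just N) ∎
    where
      open ⇔-Reasoning
      c s : ℕ
      c = length pre
      s = suc (length w)
      rest : List Step
      rest = phiBlocks M ((M′ , w′) ∷ bs)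
      pre′ : List ℕ
      pre′ = pre ++ M ∷ w
      σ≡′ : σ ≡ pre′ ++ flatten ((M′ , w′) ∷ bs)
      σ≡′ = trans σ≡ (sym (++-assoc pre (M ∷ w) _))
      M≤N : M ≤ N
      M≤N = entry-≤N pre M _ σ≡
      c≤prev : c ≤ prev
      c≤prev = prefix-bound pre _ σ≡ pre≤prev (≤-trans (<⇒≤ prev<M) M≤N)
      length-pre′ : length pre′ ≡ c + s
      length-pre′ = length-++ pre
      height : (prev ∸ c) + (M ∸ prev) ≡ s + (M ∸ length pre′)
      height = trans (block-height s c≤prev (<⇒≤ prev<M)
                       (subst (_≤ M) length-pre′ (prefix-bound pre′ _ σ≡′ (block-bounded pre≤prev prev<M w≤M) M≤N)))
                     (cong (λ t → s + (M ∸ t)) (sym length-pre′))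

proposition3 : (n : ℕ) (σ : List ℕ) → IsPerm (suc n) σ →
    AvoidsAll T₁ σ ⊎ AvoidsAll T₂ σ →
    IsDyckPath (Φ σ) ⇔ (last σ ≡ just (suc n))
proposition3 n [] perm _ = contradiction (Permutation.length-σ n perm) 0≢1+n
proposition3 n (x ∷ xs) perm _ with blocksFrom-decomposes x xs | Permutation.σ-bounded n perm
... | xs≡ , w≤x , good | (0<x , _) ∷ _ =
  Permutation.blocks-Dyck n perm 0 [] x _ _ (cong (x ∷_) xs≡) [] (0<x , w≤x , good)
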